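{- Let $n\ge 2$ and let $D_n=\langle a,b\mid a^n=e,\ b^2=e,\ bab^{ -1}=a^{ -1}\rangle$. The following are equivalent: (1) $n$ is prime; (2) the intersection hypergraph $\tilde{\Gamma}_\mathcal{H}(D_n)$ has exactly one hyperedge; (3) $\tilde{\Gamma}_\mathcal{H}(D_n)$ is a star.
   Context: For a group $G$, let $S$ be the set of all non-trivial proper subgroups of $G$. The intersection hypergraph $\tilde{\Gamma}_\mathcal{H}(G)$ has vertex set $V=\{H\in S \mid H\cap K=\{e\}\text{ for some }K\in S\}$, and a subset $E\subseteq V$ is a hyperedge iff any two distinct members of $E$ intersect trivially and $E$ is maximal among subsets of $V$ with this property. A hypergraph is a star if some vertex belongs to all of its hyperedges. -}

module Defs where

open import Level using (Level; 0ℓ) renaming (suc to lsuc)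
open import Data.Nat using (ℕ; _+_; _∸_; NonZero)
open import Data.Nat.DivMod using (_mod_)
open import Data.Fin using (Fin; toℕ)
open import Data.Bool using (Bool; true; false; not)
open import Data.Vec using (Vec; lookup)
open import Data.Product using (Σ; _×_; _,_; ∃)
open import Relation.Binary.PropositionalEquality using (_≡_)
open import Relation.Nullary using (¬_)
open import Function.Bundles using (_⇔_)

-- Concrete model of the dihedral group
--   D_n = < a, b | a^n = e, b^2 = e, b a b⁻¹ = a⁻¹ >  (order 2n).
-- The element (i , s) stands for a^i b^s  (i mod n, s = true means one factor b).
module Dihedral (n : ℕ) .{{_ : NonZero n}} where

  Elem : Set
  Elem = Fin n × Bool

  e : Elem
  e = (0 mod n , false)

  -- a^i b^s · a^j b^t = a^(i + (-1)^s j) b^(s+t)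
  infixl 7 _·_
  _·_ : Elem → Elem → Elem
  (i , false) · (j , t) = ((toℕ i + toℕ j) mod n , t)
  (i , true)  · (j , t) = ((toℕ i + (n ∸ toℕ j)) mod n , not t)

  _⁻¹ : Elem → Elem
  (i , false) ⁻¹ = ((n ∸ toℕ i) mod n , false)
  (i , true)  ⁻¹ = (i , true)

  -- A subset of D_n, given by its characteristic vectors on
  -- rotations a^i and on reflections a^i b.  Equality of subsets is _≡_.
  Sub : Set
  Sub = Vec Bool n × Vec Bool n

  infix 4 _∈_
  _∈_ : Elem → Sub → Set
  (i , false) ∈ (R , S) = lookup R i ≡ true
  (i , true)  ∈ (R , S) = lookup S i ≡ true

  record IsSubgroup (H : Sub) : Set where
    field
      has-e  : e ∈ H
      closed : ∀ x y → x ∈ H → y ∈ H → x · y ∈ H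
      inv    : ∀ x → x ∈ H → x ⁻¹ ∈ H

  InS : Sub → Set
  InS H = IsSubgroup H × (∃ λ x → x ∈ H × ¬ (x ≡ e)) × (∃ λ x → ¬ (x ∈ H))

  TrivInt : Sub → Sub → Set
  TrivInt H K = ∀ x → x ∈ H → x ∈ K → x ≡ e

  Vertex : Sub → Set
  Vertex H = InS H × (∃ λ K → InS K × TrivInt H K)

  Family : Set₁
  Family = Sub → Set

  Admissible : Family → Set
  Admissible F = (∀ H → F H → Vertex H)
               × (∀ H K → F H → F K → ¬ (H ≡ K) → TrivInt H K)

  IsHyperedge : Family → Set₁
  IsHyperedge E = Admissible E
                × (∀ (F : Family) → Admissible F → (∀ H → E H → F H) → ∀ H → F H → E H)

  -- exactly one hyperedge (hyperedges compared as sets, extensionally)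
  ExactlyOneHyperedge : Set₁
  ExactlyOneHyperedge =
    Σ Family λ E → IsHyperedge E × (∀ E′ → IsHyperedge E′ → ∀ H → (E′ H ⇔ E H))

  IsStar : Set₁
  IsStar = Σ Sub λ H → Vertex H × (∀ E → IsHyperedge E → E H)

{-# OPTIONS --safe #-}
module Submission where

open import Defs
open import Data.Bool using (Bool; true; false) renaming (_≟_ to _≟ᵇ_)
open import Data.Bool.Properties using (⇔→≡)
open import Data.Empty using (⊥-elim)
open import Data.Fin using (Fin; zero; suc; toℕ)
open import Data.Fin.Properties using (toℕ-injective; toℕ<n; toℕ≤n; toℕ-fromℕ<; fromℕ<-cong)
  renaming (_≟_ to _≟ᶠ_)
open import Data.List using (List; []; _∷_; [_]; map; _++_; cartesianProduct; allFin)
open import Data.List.Membership.Propositional using (lose) renaming (_∈_ to _∈ₗ_)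
open import Data.List.Membership.Propositional.Properties using (∈-map⁺; ∈-++⁺ˡ; ∈-++⁺ʳ; ∈-cartesianProduct⁺; ∈-allFin)
open import Data.List.Relation.Binary.Subset.Propositional using (_⊆_)
open import Data.List.Relation.Unary.All as All using (All; [])
open import Data.List.Relation.Unary.All.Properties using (anti-mono)
open import Data.List.Relation.Unary.Any as Any using (here; there; satisfied)
open import Data.Nat using (ℕ; zero; suc; _+_; _*_; _∸_; _%_; _/_; _<_; _≤_; z≤n; s≤s; NonZero; nonTrivial⇒n>1)
open import Data.Nat.Properties
  using (+-assoc; +-comm; *-identityʳ; m+[n∸m]≡n; m∸n+n≡m; m∸[m∸n]≡n; <⇒≤; <⇒≢; m<n⇒n≢0)
open import Data.Nat.DivMod
  using (_mod_; m%n<n; m≡m%n+[m/n]*n; %-distribˡ-+; m%n%n≡m%n; [m+n]%n≡m%n; [m+kn]%n≡m%n; m*n%n≡0;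
         m<n⇒m%n≡m; %-pred-≡0; %-remove-+ˡ)
open import Data.Nat.Divisibility
  using (_∣_; _∣?_; ∣-refl; _∣0; ∣1⇒≡1; ∣m∣n⇒∣m+n; ∣m+n∣m⇒∣n; ∣n⇒∣m*n; %-presˡ-∣; m%n≡0⇒n∣m; n∣m⇒m%n≡0)
open import Data.Nat.Tactic.RingSolver using (solve-∀)
open import Data.Nat.Coprimality using (coprime-Bézout; prime⇒coprime)
open import Data.Nat.GCD using (module Bézout)
open import Data.Nat.Primality using (Prime; prime; composite)
open import Data.Product using (Σ; ∃; _×_; _,_; proj₁; map₂)
open import Data.Product.Properties using (≡-dec)
open import Data.Sum using (_⊎_; inj₁; inj₂; [_,_]′)
open import Data.Vec using (Vec; []; _∷_; lookup; tabulate)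
open import Data.Vec.Properties using (tabulate∘lookup; tabulate-cong; lookup∘tabulate) renaming (≡-dec to ≡-decᵛ)
open import Function using (_∘_; _⇔_; mk⇔; Equivalence)
open import Relation.Binary.Definitions using (DecidableEquality)
open import Relation.Binary.PropositionalEquality
  using (_≡_; _≢_; refl; sym; trans; cong; cong₂; subst; module ≡-Reasoning)
open import Relation.Nullary using (¬_; Dec; yes; no; does)
open import Relation.Nullary.Decidable using (map′; _×-dec_; _→-dec_; ¬?)

-- For prime n the nontrivial proper subgroups of D_n are ⟨a⟩ and the subgroups ⟨a^i b⟩ of
-- order 2, so distinct ones meet trivially and the whole vertex set is the unique hyperedge.
-- A unique hyperedge makes the hypergraph a star because every vertex, e.g. ⟨a⟩, lies in some
-- hyperedge: D_n has finitely many subsets, so a greedy pass extends a vertex to a maximal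
-- clique of the graph "meets trivially".  If instead d is a proper nontrivial divisor of n,
-- a star centre C must equal or meet trivially every vertex.  C = ⟨a⟩ is refuted by the vertex
-- ⟨a^d, b⟩, and if C ∩ ⟨a⟩ = {e} then C contains a reflection a^i b, which it shares with the
-- vertex ⟨a^d, a^i b⟩ ≠ C.

allVecs : (k : ℕ) → List (Vec Bool k)
allVecs zero    = [] ∷ []
allVecs (suc k) = map (true ∷_) (allVecs k) ++ map (false ∷_) (allVecs k)

∈-allVecs : ∀ {k} (v : Vec Bool k) → v ∈ₗ allVecs k
∈-allVecs []                  = here refl
∈-allVecs (true ∷ v)          = ∈-++⁺ˡ (∈-map⁺ (true ∷_) (∈-allVecs v))
∈-allVecs {suc k} (false ∷ v) = ∈-++⁺ʳ (map (true ∷_) (allVecs k)) (∈-map⁺ (false ∷_) (∈-allVecs v))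

module _ {A : Set} {xs : List A} (complete : ∀ x → x ∈ₗ xs)
         {P : A → Set} (P? : ∀ x → Dec (P x)) where

  all?-complete : Dec (∀ x → P x)
  all?-complete = map′ (λ ps x → All.lookup ps (complete x)) (λ ps → All.tabulate (λ {x} _ → ps x))
                       (All.all? P? xs)

  any?-complete : Dec (∃ P)
  any?-complete = map′ satisfied (λ (x , px) → lose (complete x) px) (Any.any? P? xs)

module MaximalCliques {A : Set} (_≟_ : DecidableEquality A) {xs : List A} (complete : ∀ x → x ∈ₗ xs)
                      {V : A → Set} (V? : ∀ x → Dec (V x))
                      {R : A → A → Set} (R? : ∀ x y → Dec (R x y)) (R-sym : ∀ {x y} → R x y → R y x)
                      where

  Clique : (A → Set) → Set
  Clique F = (∀ x → F x → V x) × (∀ x y → F x → F y → ¬ x ≡ y → R x y)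

  IsMaximalClique : (A → Set) → Set₁
  IsMaximalClique E = Clique E × (∀ (F : A → Set) → Clique F → (∀ x → E x → F x) → ∀ x → F x → E x)

  Compatible : List A → A → Set
  Compatible ys y = V y × All (λ z → ¬ y ≡ z → R y z) ys

  compatible? : ∀ ys y → Dec (Compatible ys y)
  compatible? ys y = V? y ×-dec All.all? (λ z → ¬? (y ≟ z) →-dec R? y z) ys

  Compatible-anti : ∀ {ys zs y} → ys ⊆ zs → Compatible zs y → Compatible ys y
  Compatible-anti ys⊆zs = map₂ (anti-mono ys⊆zs)

  clique-∷ : ∀ {ys y} → Clique (_∈ₗ ys) → Compatible ys y → Clique (_∈ₗ y ∷ ys)
  clique-∷ {ys} {y} (ys-V , ys-R) (y-V , y-R) = V′ , R′
    where
    V′ : ∀ x → x ∈ₗ y ∷ ys → V x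
    V′ x (here refl) = y-V
    V′ x (there x∈ys) = ys-V x x∈ys

    R′ : ∀ x z → x ∈ₗ y ∷ ys → z ∈ₗ y ∷ ys → ¬ x ≡ z → R x z
    R′ x z (here refl)  (here refl)  x≢z = ⊥-elim (x≢z refl)
    R′ x z (here refl)  (there z∈ys) x≢z = All.lookup y-R z∈ys x≢z
    R′ x z (there x∈ys) (here refl)  x≢z = R-sym (All.lookup y-R x∈ys (x≢z ∘ sym))
    R′ x z (there x∈ys) (there z∈ys) x≢z = ys-R x z x∈ys z∈ys x≢z

  -- Since
  -- compatibility can only be lost as the kept list grows, every candidate compatible with the
  -- final list was kept.
  greedy : List A → List A → List A
  greedy ys []       = ys
  greedy ys (z ∷ zs) with compatible? ys z
  ... | yes _ = greedy (z ∷ ys) zs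
  ... | no  _ = greedy ys zs

  ⊆-greedy : ∀ ys zs → ys ⊆ greedy ys zs
  ⊆-greedy ys []       y∈ys = y∈ys
  ⊆-greedy ys (z ∷ zs) y∈ys with compatible? ys z
  ... | yes _ = ⊆-greedy (z ∷ ys) zs (there y∈ys)
  ... | no  _ = ⊆-greedy ys zs y∈ys

  greedy-clique : ∀ ys zs → Clique (_∈ₗ ys) → Clique (_∈ₗ greedy ys zs)
  greedy-clique ys []       ys-clique = ys-clique
  greedy-clique ys (z ∷ zs) ys-clique with compatible? ys z
  ... | yes z-compat = greedy-clique (z ∷ ys) zs (clique-∷ ys-clique z-compat)
  ... | no  _     = greedy-clique ys zs ys-clique

  greedy-saturated : ∀ ys zs {y} → y ∈ₗ zs → Compatible (greedy ys zs) y → y ∈ₗ greedy ys zs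
  greedy-saturated ys (z ∷ zs) y∈ y-compat with compatible? ys z | y∈
  ... | yes _     | here refl  = ⊆-greedy (z ∷ ys) zs (here refl)
  ... | no  ¬z-compat | here refl = ⊥-elim (¬z-compat (Compatible-anti (⊆-greedy ys zs) y-compat))
  ... | yes _     | there y∈zs = greedy-saturated (z ∷ ys) zs y∈zs y-compat
  ... | no  _     | there y∈zs = greedy-saturated ys zs y∈zs y-compat

  saturated⇒maximal : ∀ {ys} → Clique (_∈ₗ ys) → (∀ y → Compatible ys y → y ∈ₗ ys) →
                      IsMaximalClique (_∈ₗ ys)
  saturated⇒maximal ys-clique saturated = ys-clique , λ F (F-V , F-R) ys⊆F y Fy →
    saturated y (F-V y Fy , All.tabulate λ {z} z∈ys y≢z → F-R y z Fy (ys⊆F z z∈ys) y≢z)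

  maximalClique-∋ : ∀ {x} → V x → Σ (A → Set) λ E → IsMaximalClique E × E x
  maximalClique-∋ {x} x-V =
    (_∈ₗ greedy [ x ] xs) ,
    saturated⇒maximal (greedy-clique [ x ] xs singleton) (λ y → greedy-saturated [ x ] xs (complete y)) ,
    ⊆-greedy [ x ] xs (here refl)
    where
    singleton : Clique (_∈ₗ [ x ])
    singleton = clique-∷ ((λ _ ()) , (λ _ _ ())) (x-V , [])

∣m%n+o⇔∣m+o : ∀ {d} m n o .{{_ : NonZero n}} → d ∣ n → d ∣ m % n + o ⇔ d ∣ m + o
∣m%n+o⇔∣m+o {d} m n o d∣n = mk⇔
  (λ d∣r+o → subst (d ∣_) split (∣m∣n⇒∣m+n d∣qn d∣r+o))
  (λ d∣m+o → ∣m+n∣m⇒∣n (subst (d ∣_) (sym split) d∣m+o) d∣qn)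
  where
  d∣qn : d ∣ (m / n) * n
  d∣qn = ∣n⇒∣m*n (m / n) d∣n
  split : (m / n) * n + (m % n + o) ≡ m + o
  split = begin
    (m / n) * n + (m % n + o) ≡⟨ +-assoc (m / n * n) (m % n) o ⟨
    (m / n) * n + m % n + o   ≡⟨ cong (_+ o) (+-comm (m / n * n) (m % n)) ⟩
    m % n + (m / n) * n + o   ≡⟨ cong (_+ o) (m≡m%n+[m/n]*n m n) ⟨
    m + o                     ∎
    where open ≡-Reasoning

[m%n+o]%n≡[m+o]%n : ∀ m o n .{{_ : NonZero n}} → (m % n + o) % n ≡ (m + o) % n
[m%n+o]%n≡[m+o]%n m o n = begin
  (m % n + o) % n         ≡⟨ %-distribˡ-+ (m % n) o n ⟩
  (m % n % n + o % n) % n ≡⟨ cong (λ r → (r + o % n) % n) (m%n%n≡m%n m n) ⟩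
  (m % n + o % n) % n     ≡⟨ %-distribˡ-+ m o n ⟨
  (m + o) % n             ∎
  where open ≡-Reasoning

∣n⇒∣n∸m : ∀ {d m n} → m ≤ n → d ∣ n → d ∣ m → d ∣ n ∸ m
∣n⇒∣n∸m {d} m≤n d∣n d∣m = ∣m+n∣m⇒∣n (subst (d ∣_) (sym (m+[n∸m]≡n m≤n)) d∣n) d∣m

∣∸-shift : ∀ {d n j k o} → k ≤ n → d ∣ n → d ∣ j + o → d ∣ k + o → d ∣ j + (n ∸ k)
∣∸-shift {d} {n} {j} {k} {o} k≤n d∣n d∣j+o d∣k+o =
  ∣m+n∣m⇒∣n (subst (d ∣_) sums (∣m∣n⇒∣m+n d∣j+o d∣n)) d∣k+o
  where
  sums : (j + o) + n ≡ (k + o) + (j + (n ∸ k))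
  sums = begin
    (j + o) + n                   ≡⟨ cong ((j + o) +_) (m+[n∸m]≡n k≤n) ⟨
    (j + o) + (k + (n ∸ k))       ≡⟨ rearrange j o k (n ∸ k) ⟩
    (k + o) + (j + (n ∸ k))       ∎
    where
    open ≡-Reasoning
    rearrange : ∀ a b c e → (a + b) + (c + e) ≡ (c + b) + (a + e)
    rearrange = solve-∀

n∣m⇒m<n⇒m≡0 : ∀ {m n} .{{_ : NonZero n}} → n ∣ m → m < n → m ≡ 0
n∣m⇒m<n⇒m≡0 {m} {n} n∣m m<n = trans (sym (m<n⇒m%n≡m m<n)) (n∣m⇒m%n≡0 m n n∣m)

n∣m+[n∸o]⇒m≡o : ∀ {m n o} .{{_ : NonZero n}} → m < n → o < n → n ∣ m + (n ∸ o) → m ≡ o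
n∣m+[n∸o]⇒m≡o {m} {n} {o} m<n o<n n∣m+[n∸o] = begin
  m                         ≡⟨ m<n⇒m%n≡m m<n ⟨
  m % n                     ≡⟨ [m+n]%n≡m%n m n ⟨
  (m + n) % n               ≡⟨ cong (_% n) sums ⟨
  (m + (n ∸ o) + o) % n     ≡⟨ %-remove-+ˡ o n∣m+[n∸o] ⟩
  o % n                     ≡⟨ m<n⇒m%n≡m o<n ⟩
  o                         ∎
  where
  open ≡-Reasoning
  sums : m + (n ∸ o) + o ≡ m + n
  sums = trans (+-assoc m (n ∸ o) o) (cong (m +_) (m∸n+n≡m (<⇒≤ o<n)))

does≡true⇔ : {P : Set} (P? : Dec P) → does P? ≡ true ⇔ P
does≡true⇔ (yes p)  = mk⇔ (λ _ → p) (λ _ → refl)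
does≡true⇔ (no ¬p) = mk⇔ (λ ()) (⊥-elim ∘ ¬p)

module DihedralHypergraph (n : ℕ) .{{_ : NonZero n}} where
  open Dihedral n

  allElems : List Elem
  allElems = cartesianProduct (allFin n) (true ∷ false ∷ [])

  ∈-allElems : ∀ x → x ∈ₗ allElems
  ∈-allElems (i , true)  = ∈-cartesianProduct⁺ (∈-allFin i) (here refl)
  ∈-allElems (i , false) = ∈-cartesianProduct⁺ (∈-allFin i) (there (here refl))

  allSubs : List Sub
  allSubs = cartesianProduct (allVecs n) (allVecs n)

  ∈-allSubs : ∀ H → H ∈ₗ allSubs
  ∈-allSubs (R , S) = ∈-cartesianProduct⁺ (∈-allVecs R) (∈-allVecs S)

  _≟ᴱ_ : DecidableEquality Elem
  _≟ᴱ_ = ≡-dec _≟ᶠ_ _≟ᵇ_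

  _≟ˢ_ : DecidableEquality Sub
  _≟ˢ_ = ≡-dec (≡-decᵛ _≟ᵇ_) (≡-decᵛ _≟ᵇ_)

  infix 4 _∈?_
  _∈?_ : ∀ x H → Dec (x ∈ H)
  (i , false) ∈? (R , S) = lookup R i ≟ᵇ true
  (i , true)  ∈? (R , S) = lookup S i ≟ᵇ true

  isSubgroup? : ∀ H → Dec (IsSubgroup H)
  isSubgroup? H = map′ (λ (e∈ , ·∈ , ⁻¹∈) → record { has-e = e∈ ; closed = ·∈ ; inv = ⁻¹∈ })
                       (λ H-sub → IsSubgroup.has-e H-sub , IsSubgroup.closed H-sub , IsSubgroup.inv H-sub)
                       (e ∈? H ×-dec
                        ∀ᴱ? (λ x → ∀ᴱ? λ y → x ∈? H →-dec (y ∈? H →-dec x · y ∈? H)) ×-dec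
                        ∀ᴱ? (λ x → x ∈? H →-dec x ⁻¹ ∈? H))
    where
    ∀ᴱ? : {P : Elem → Set} → (∀ x → Dec (P x)) → Dec (∀ x → P x)
    ∀ᴱ? = all?-complete ∈-allElems

  inS? : ∀ H → Dec (InS H)
  inS? H = isSubgroup? H ×-dec
           any?-complete ∈-allElems (λ x → x ∈? H ×-dec ¬? (x ≟ᴱ e)) ×-dec
           any?-complete ∈-allElems (λ x → ¬? (x ∈? H))

  trivInt? : ∀ H K → Dec (TrivInt H K)
  trivInt? H K = all?-complete ∈-allElems λ x → x ∈? H →-dec (x ∈? K →-dec x ≟ᴱ e)

  trivInt-sym : ∀ {H K} → TrivInt H K → TrivInt K H
  trivInt-sym H∩K x x∈K x∈H = H∩K x x∈H x∈K

  vertex? : ∀ H → Dec (Vertex H)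
  vertex? H = inS? H ×-dec any?-complete ∈-allSubs (λ K → inS? K ×-dec trivInt? H K)

  Sub-ext : ∀ {H K} → (∀ x → x ∈ H → x ∈ K) → (∀ x → x ∈ K → x ∈ H) → H ≡ K
  Sub-ext {_ , _} {_ , _} H⊆K K⊆H = cong₂ _,_ (Vec-ext (λ i → H⊆K (i , false)) (λ i → K⊆H (i , false)))
                                              (Vec-ext (λ i → H⊆K (i , true)) (λ i → K⊆H (i , true)))
    where
    Vec-ext : ∀ {u v : Vec Bool n} → (∀ i → lookup u i ≡ true → lookup v i ≡ true) →
              (∀ i → lookup v i ≡ true → lookup u i ≡ true) → u ≡ v
    Vec-ext {u} {v} u⊆v v⊆u = begin
      u                   ≡⟨ tabulate∘lookup u ⟨
      tabulate (lookup u) ≡⟨ tabulate-cong (λ i → ⇔→≡ (mk⇔ (u⊆v i) (v⊆u i))) ⟩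
      tabulate (lookup v) ≡⟨ tabulate∘lookup v ⟩
      v                   ∎
      where open ≡-Reasoning

  subset : {P : Elem → Set} → (∀ x → Dec (P x)) → Sub
  subset P? = tabulate (λ i → does (P? (i , false))) , tabulate (λ i → does (P? (i , true)))

  ∈-subset : ∀ {P : Elem → Set} (P? : ∀ x → Dec (P x)) x → x ∈ subset P? ⇔ P x
  ∈-subset {P} P? x@(i , false) = subst (λ b → b ≡ true ⇔ P x) (sym (lookup∘tabulate _ i)) (does≡true⇔ (P? x))
  ∈-subset {P} P? x@(i , true)  = subst (λ b → b ≡ true ⇔ P x) (sym (lookup∘tabulate _ i)) (does≡true⇔ (P? x))

  subset-isSubgroup : ∀ {P : Elem → Set} (P? : ∀ x → Dec (P x)) → P e → (∀ x y → P x → P y → P (x · y)) →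
                      (∀ x → P x → P (x ⁻¹)) → IsSubgroup (subset P?)
  subset-isSubgroup {P} P? Pe P· P⁻¹ = record
    { has-e  = from e Pe
    ; closed = λ x y x∈ y∈ → from (x · y) (P· x y (to x x∈) (to y y∈))
    ; inv    = λ x x∈ → from (x ⁻¹) (P⁻¹ x (to x x∈))
    }
    where
    to : ∀ x → x ∈ subset P? → P x
    to x = Equivalence.to (∈-subset P? x)
    from : ∀ x → P x → x ∈ subset P?
    from x = Equivalence.from (∈-subset P? x)

  -- Admissible and IsHyperedge are Clique and IsMaximalClique for the graph on V whose edges join
  -- subgroups meeting trivially.
  open MaximalCliques _≟ˢ_ ∈-allSubs vertex? trivInt? trivInt-sym

  hyperedge-∋ : ∀ {H} → Vertex H → Σ Family λ E → IsHyperedge E × E H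
  hyperedge-∋ = maximalClique-∋

  star-center-meets : ∀ {C H} → (∀ E → IsHyperedge E → E C) → Vertex H → C ≡ H ⊎ TrivInt C H
  star-center-meets {C} {H} C∈all H-vertex with C ≟ˢ H
  ... | yes C≡H = inj₁ C≡H
  ... | no  C≢H with hyperedge-∋ H-vertex
  ...   | E , E-edge@((_ , E-pairwise) , _) , H∈E = inj₂ (E-pairwise C H (C∈all E E-edge) H∈E C≢H)

module Dihedral≥2 (m : ℕ) where

  n : ℕ
  n = 2 + m

  open Dihedral n
  open DihedralHypergraph n

  toℕ-mod : ∀ k → toℕ (k mod n) ≡ k % n
  toℕ-mod k = toℕ-fromℕ< (m%n<n k n)

  mod-cong : ∀ j k → j % n ≡ k % n → j mod n ≡ k mod n
  mod-cong j k eq = fromℕ<-cong (j % n) (k % n) eq (m%n<n j n) (m%n<n k n)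

  mod-toℕ : ∀ (i : Fin n) → toℕ i mod n ≡ i
  mod-toℕ i = toℕ-injective (trans (toℕ-mod (toℕ i)) (m<n⇒m%n≡m (toℕ<n i)))

  rot : ℕ → Elem
  rot k = (k mod n , false)

  rot-toℕ : ∀ i → rot (toℕ i) ≡ (i , false)
  rot-toℕ i = cong (_, false) (mod-toℕ i)

  rot-· : ∀ j k → rot j · rot k ≡ rot (j + k)
  rot-· j k = cong (_, false) (mod-cong (toℕ (j mod n) + toℕ (k mod n)) (j + k) (begin
    (toℕ (j mod n) + toℕ (k mod n)) % n ≡⟨ cong₂ (λ a b → (a + b) % n) (toℕ-mod j) (toℕ-mod k) ⟩
    (j % n + k % n) % n                 ≡⟨ %-distribˡ-+ j k n ⟨
    (j + k) % n                         ∎))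
    where open ≡-Reasoning

  rot-·-reflection : ∀ j i → rot j · (i , true) ≡ ((j + toℕ i) mod n , true)
  rot-·-reflection j i = cong (_, true) (mod-cong (toℕ (j mod n) + toℕ i) (j + toℕ i) (begin
    (toℕ (j mod n) + toℕ i) % n ≡⟨ cong (λ a → (a + toℕ i) % n) (toℕ-mod j) ⟩
    (j % n + toℕ i) % n         ≡⟨ [m%n+o]%n≡[m+o]%n j (toℕ i) n ⟩
    (j + toℕ i) % n             ∎))
    where open ≡-Reasoning

  rot-⁻¹ : ∀ k → rot k ⁻¹ ≡ rot (n ∸ k % n)
  rot-⁻¹ k = cong (λ r → rot (n ∸ r)) (toℕ-mod k)

  reflection-·-reflection-≢e : ∀ {i k} → i ≢ k → (i , true) · (k , true) ≢ e
  reflection-·-reflection-≢e {i} {k} i≢k eq = i≢k (toℕ-injective (n∣m+[n∸o]⇒m≡o (toℕ<n i) (toℕ<n k)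
    (m%n≡0⇒n∣m _ n (trans (sym (toℕ-mod (toℕ i + (n ∸ toℕ k)))) (cong (toℕ ∘ proj₁) eq)))))

  module _ {H} (H-sub : IsSubgroup H) where
    open IsSubgroup H-sub

    rot-pow∈ : ∀ {j} → rot j ∈ H → ∀ k → rot (k * j) ∈ H
    rot-pow∈ j∈H zero    = has-e
    rot-pow∈ {j} j∈H (suc k) =
      subst (_∈ H) (rot-· j (k * j)) (closed (rot j) (rot (k * j)) j∈H (rot-pow∈ j∈H k))

    rot1∈⇒rotations∈ : rot 1 ∈ H → ∀ i → (i , false) ∈ H
    rot1∈⇒rotations∈ rot1∈H i =
      subst (_∈ H) (trans (cong rot (*-identityʳ (toℕ i))) (rot-toℕ i)) (rot-pow∈ rot1∈H (toℕ i))

    rotations∈+reflection∈⇒all∈ : (∀ i → (i , false) ∈ H) → ∀ {i} → (i , true) ∈ H → ∀ x → x ∈ H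
    rotations∈+reflection∈⇒all∈ rotations∈H i∈H (k , false) = rotations∈H k
    rotations∈+reflection∈⇒all∈ rotations∈H {i} i∈H (k , true) =
      subst (_∈ H) (trans (rot-·-reflection (toℕ k + (n ∸ toℕ i)) i) (cong (_, true) k+[n∸i]+i≡k))
        (closed (rot (toℕ k + (n ∸ toℕ i))) (i , true) (rotations∈H _) i∈H)
      where
      k+[n∸i]+i≡k : (toℕ k + (n ∸ toℕ i) + toℕ i) mod n ≡ k
      k+[n∸i]+i≡k = trans (mod-cong (toℕ k + (n ∸ toℕ i) + toℕ i) (toℕ k) (begin
        (toℕ k + (n ∸ toℕ i) + toℕ i) % n ≡⟨ cong (_% n) (+-assoc (toℕ k) (n ∸ toℕ i) (toℕ i)) ⟩
        (toℕ k + (n ∸ toℕ i + toℕ i)) % n ≡⟨ cong (λ r → (toℕ k + r) % n) (m∸n+n≡m (toℕ≤n i)) ⟩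
        (toℕ k + n) % n                   ≡⟨ [m+n]%n≡m%n (toℕ k) n ⟩
        toℕ k % n                         ∎)) (mod-toℕ k)
        where open ≡-Reasoning

    prime⇒rot∈⇒rot1∈ : Prime n → ∀ {j} .{{_ : NonZero j}} → j < n → rot j ∈ H → rot 1 ∈ H
    -- Bézout gives y with y j ≡ 1 or y j ≡ -1 (mod n); in the second case invert a^(y j).
    prime⇒rot∈⇒rot1∈ p {j} j<n j∈H with coprime-Bézout (prime⇒coprime p j<n)
    ... | Bézout.-+ x y 1+xn≡yj = subst (_∈ H) (cong (_, false) (mod-cong (y * j) 1 (begin
      (y * j) % n     ≡⟨ cong (_% n) 1+xn≡yj ⟨
      (1 + x * n) % n ≡⟨ [m+kn]%n≡m%n 1 x n ⟩
      1 % n           ∎))) (rot-pow∈ {j} j∈H y)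
      where open ≡-Reasoning
    ... | Bézout.+- x y 1+yj≡xn = subst (_∈ H) (trans (rot-⁻¹ (y * j)) (cong rot (begin
      n ∸ (y * j) % n ≡⟨ cong (n ∸_) (%-pred-≡0 {y * j} {n} (trans (cong (_% n) 1+yj≡xn) (m*n%n≡0 x n)))
                       ⟩
      n ∸ (n ∸ 1)     ≡⟨ m∸[m∸n]≡n {n} {1} (s≤s z≤n) ⟩
      1               ∎))) (inv (rot (y * j)) (rot-pow∈ {j} j∈H y))
      where open ≡-Reasoning

    prime⇒rotation∈⇒rotations∈ : Prime n → ∀ {i} → (i , false) ∈ H → i ≢ zero → ∀ k → (k , false) ∈ H
    prime⇒rotation∈⇒rotations∈ p {zero}  _   i≢0 = ⊥-elim (i≢0 refl)
    prime⇒rotation∈⇒rotations∈ p {suc i} i∈H _   = rot1∈⇒rotations∈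
      (prime⇒rot∈⇒rot1∈ p (toℕ<n (suc i)) (subst (_∈ H) (sym (rot-toℕ (suc i))) i∈H))

  module _ (p : Prime n) where

    rotation∈⇒reflection∉ : ∀ {H j i} → InS H → (j , false) ∈ H → j ≢ zero → ¬ (i , true) ∈ H
    rotation∈⇒reflection∉ (H-sub , _ , x , x∉H) j∈H j≢0 i∈H =
      x∉H (rotations∈+reflection∈⇒all∈ H-sub (prime⇒rotation∈⇒rotations∈ H-sub p j∈H j≢0) i∈H x)

    reflection∈⇒≡e⊎≡reflection : ∀ {H i} → InS H → (i , true) ∈ H → ∀ {y} → y ∈ H → y ≡ e ⊎ y ≡ (i , true)
    reflection∈⇒≡e⊎≡reflection H-inS i∈H {k , false} k∈H with k ≟ᶠ zero
    ... | yes refl = inj₁ refl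
    ... | no  k≢0  = ⊥-elim (rotation∈⇒reflection∉ H-inS k∈H k≢0 i∈H)
    reflection∈⇒≡e⊎≡reflection {i = i} H-inS i∈H {k , true} k∈H with k ≟ᶠ i
    ... | yes refl = inj₂ refl
    ... | no  k≢i  = ⊥-elim (rotation∈⇒reflection∉ H-inS
                       (IsSubgroup.closed (proj₁ H-inS) (i , true) (k , true) i∈H k∈H)
                       (reflection-·-reflection-≢e (k≢i ∘ sym) ∘ cong (_, false))
                       i∈H)

    shared-nontrivial⇒⊆ : ∀ {H K x} → InS H → InS K → x ∈ H → x ∈ K → x ≢ e → ∀ y → y ∈ H → y ∈ K
    shared-nontrivial⇒⊆ {x = j , false} H-inS K-inS j∈H j∈K j≢e (k , false) _ =
      prime⇒rotation∈⇒rotations∈ (proj₁ K-inS) p j∈K (j≢e ∘ cong (_, false)) k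
    shared-nontrivial⇒⊆ {x = j , false} H-inS K-inS j∈H j∈K j≢e (k , true) k∈H =
      ⊥-elim (rotation∈⇒reflection∉ H-inS j∈H (j≢e ∘ cong (_, false)) k∈H)
    shared-nontrivial⇒⊆ {x = i , true} H-inS K-inS i∈H i∈K _ y y∈H
      with reflection∈⇒≡e⊎≡reflection H-inS i∈H y∈H
    ... | inj₁ refl = IsSubgroup.has-e (proj₁ K-inS)
    ... | inj₂ refl = i∈K

    distinct-subgroups-meet-trivially : ∀ {H K} → InS H → InS K → H ≢ K → TrivInt H K
    distinct-subgroups-meet-trivially H-inS K-inS H≢K x x∈H x∈K with x ≟ᴱ e
    ... | yes x≡e = x≡e
    ... | no  x≢e = ⊥-elim (H≢K (Sub-ext (shared-nontrivial⇒⊆ H-inS K-inS x∈H x∈K x≢e)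
                                         (shared-nontrivial⇒⊆ K-inS H-inS x∈K x∈H x≢e)))

    vertices-admissible : Admissible Vertex
    vertices-admissible = (λ _ H-vertex → H-vertex) ,
      λ H K H-vertex K-vertex → distinct-subgroups-meet-trivially (proj₁ H-vertex) (proj₁ K-vertex)

    prime⇒exactlyOneHyperedge : ExactlyOneHyperedge
    prime⇒exactlyOneHyperedge =
      Vertex , (vertices-admissible , λ F (F⊆V , _) _ H H∈F → F⊆V H H∈F) ,
      λ E ((E⊆V , _) , E-maximal) H → mk⇔ (E⊆V H) (E-maximal Vertex vertices-admissible E⊆V H)

  IsRotation : Elem → Set
  IsRotation (_ , s) = s ≡ false

  isRotation? : ∀ x → Dec (IsRotation x)
  isRotation? (_ , s) = s ≟ᵇ false

  IsRotation-· : ∀ x y → IsRotation x → IsRotation y → IsRotation (x · y)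
  IsRotation-· (_ , false) (_ , false) refl refl = refl

  IsRotation-⁻¹ : ∀ x → IsRotation x → IsRotation (x ⁻¹)
  IsRotation-⁻¹ (_ , false) refl = refl

  rotations : Sub
  rotations = subset isRotation?

  rotations-isSubgroup : IsSubgroup rotations
  rotations-isSubgroup = subset-isSubgroup isRotation? refl IsRotation-· IsRotation-⁻¹

  rot∈rotations : ∀ i → (i , false) ∈ rotations
  rot∈rotations i = Equivalence.from (∈-subset isRotation? (i , false)) refl

  reflection∉rotations : ∀ i → ¬ (i , true) ∈ rotations
  reflection∉rotations i i∈ with Equivalence.to (∈-subset isRotation? (i , true)) i∈
  ... | ()

  rotations-inS : InS rotations
  rotations-inS =
    rotations-isSubgroup ,
    (rot 1 , rot∈rotations (1 mod n) , λ ()) ,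
    ((zero , true) , reflection∉rotations zero)

  -- dihedral d i is ⟨a^d, a^i b⟩ = {a^j | d ∣ j} ∪ {a^j b | d ∣ j - i}, where n ∸ i stands for
  -- -i mod n; in particular dihedral n i = {e, a^i b}.
  InDihedral : ℕ → Fin n → Elem → Set
  InDihedral d i (j , false) = d ∣ toℕ j
  InDihedral d i (j , true)  = d ∣ toℕ j + (n ∸ toℕ i)

  inDihedral? : ∀ d i x → Dec (InDihedral d i x)
  inDihedral? d i (j , false) = d ∣? toℕ j
  inDihedral? d i (j , true)  = d ∣? toℕ j + (n ∸ toℕ i)

  dihedral : ℕ → Fin n → Sub
  dihedral d i = subset (inDihedral? d i)

  module _ {d} (d∣n : d ∣ n) where

    mod-pres-∣ : ∀ {k} → d ∣ k → d ∣ toℕ (k mod n)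
    mod-pres-∣ {k} d∣k = subst (d ∣_) (sym (toℕ-mod k)) (%-presˡ-∣ d∣k d∣n)

    mod-+-pres-∣ : ∀ k {o} → d ∣ k + o → d ∣ toℕ (k mod n) + o
    mod-+-pres-∣ k {o} d∣k+o =
      subst (λ r → d ∣ r + o) (sym (toℕ-mod k)) (Equivalence.from (∣m%n+o⇔∣m+o k n o d∣n) d∣k+o)

  module _ {d} (d∣n : d ∣ n) (i : Fin n) where

    InDihedral-· : ∀ x y → InDihedral d i x → InDihedral d i y → InDihedral d i (x · y)
    InDihedral-· (j , false) (k , false) d∣j d∣k = mod-pres-∣ d∣n (∣m∣n⇒∣m+n d∣j d∣k)
    InDihedral-· (j , false) (k , true)  d∣j d∣k-i =
      mod-+-pres-∣ d∣n (toℕ j + toℕ k) (subst (d ∣_) (sym (+-assoc (toℕ j) (toℕ k) _)) (∣m∣n⇒∣m+n d∣j d∣k-i))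
    InDihedral-· (j , true)  (k , false) d∣j-i d∣k =
      mod-+-pres-∣ d∣n (toℕ j + (n ∸ toℕ k))
        (subst (d ∣_) (+-comm-middle (toℕ j) _ (n ∸ toℕ k)) (∣m∣n⇒∣m+n d∣j-i (∣n⇒∣n∸m (toℕ≤n k) d∣n d∣k)))
      where
      +-comm-middle : ∀ a b c → a + b + c ≡ a + c + b
      +-comm-middle = solve-∀
    InDihedral-· (j , true)  (k , true)  d∣j-i d∣k-i = mod-pres-∣ d∣n (∣∸-shift (toℕ≤n k) d∣n d∣j-i d∣k-i)

    InDihedral-⁻¹ : ∀ x → InDihedral d i x → InDihedral d i (x ⁻¹)
    InDihedral-⁻¹ (j , false) d∣j = mod-pres-∣ d∣n (∣n⇒∣n∸m (toℕ≤n j) d∣n d∣j)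
    InDihedral-⁻¹ (j , true)  d∣j-i = d∣j-i

    dihedral-isSubgroup : IsSubgroup (dihedral d i)
    dihedral-isSubgroup = subset-isSubgroup (inDihedral? d i) (d ∣0) InDihedral-· InDihedral-⁻¹

    ∈dihedral⁺ : ∀ x → InDihedral d i x → x ∈ dihedral d i
    ∈dihedral⁺ x = Equivalence.from (∈-subset (inDihedral? d i) x)

    ∈dihedral⁻ : ∀ x → x ∈ dihedral d i → InDihedral d i x
    ∈dihedral⁻ x = Equivalence.to (∈-subset (inDihedral? d i) x)

    reflection∈dihedral : (i , true) ∈ dihedral d i
    reflection∈dihedral = ∈dihedral⁺ (i , true) (subst (d ∣_) (sym (m+[n∸m]≡n (toℕ≤n i))) d∣n)

    dihedral-inS : 1 < d → InS (dihedral d i)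
    dihedral-inS 1<d = dihedral-isSubgroup , ((i , true) , reflection∈dihedral , λ ()) ,
                       (rot 1 , λ rot1∈ → <⇒≢ 1<d (sym (∣1⇒≡1 (∈dihedral⁻ (rot 1) rot1∈))))

  module _ (i : Fin n) where

    dihedral[n]-rotation : ∀ {j} → (j , false) ∈ dihedral n i → j ≡ zero
    dihedral[n]-rotation {j} j∈ =
      toℕ-injective (n∣m⇒m<n⇒m≡0 (∈dihedral⁻ ∣-refl i (j , false) j∈) (toℕ<n j))

    dihedral[n]-reflection : ∀ {j} → (j , true) ∈ dihedral n i → j ≡ i
    dihedral[n]-reflection {j} j∈ =
      toℕ-injective (n∣m+[n∸o]⇒m≡o (toℕ<n j) (toℕ<n i) (∈dihedral⁻ ∣-refl i (j , true) j∈))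

  1<n : 1 < n
  1<n = s≤s (s≤s z≤n)

  rotations-vertex : Vertex rotations
  rotations-vertex = rotations-inS , dihedral n zero , dihedral-inS ∣-refl zero 1<n , rotations∩dihedral[n]
    where
    rotations∩dihedral[n] : TrivInt rotations (dihedral n zero)
    rotations∩dihedral[n] (j , false) _  j∈ = cong (_, false) (dihedral[n]-rotation zero {j} j∈)
    rotations∩dihedral[n] (j , true)  j∈ _  = ⊥-elim (reflection∉rotations j j∈)

  dihedral-vertex : ∀ {d} → 1 < d → d ∣ n → ∀ i → Vertex (dihedral d i)
  dihedral-vertex {d} 1<d d∣n i =
    dihedral-inS d∣n i 1<d , dihedral n i′ , dihedral-inS ∣-refl i′ 1<n , dihedral∩dihedral[n]
    where
    i′ : Fin n
    i′ = (1 + toℕ i) mod n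
    d∤i′-i : ¬ d ∣ toℕ i′ + (n ∸ toℕ i)
    d∤i′-i d∣i′-i = <⇒≢ 1<d (sym (∣1⇒≡1 (∣m+n∣m⇒∣n (subst (d ∣_) (+-comm 1 n) d∣1+n) d∣n)))
      where
      d∣1+n : d ∣ 1 + n
      d∣1+n = subst (λ r → d ∣ suc r) (m+[n∸m]≡n (toℕ≤n i))
        (Equivalence.to (∣m%n+o⇔∣m+o (1 + toℕ i) n (n ∸ toℕ i) d∣n)
          (subst (λ r → d ∣ r + (n ∸ toℕ i)) (toℕ-mod (1 + toℕ i)) d∣i′-i))
    dihedral∩dihedral[n] : TrivInt (dihedral d i) (dihedral n i′)
    dihedral∩dihedral[n] (j , false) _   j∈′ = cong (_, false) (dihedral[n]-rotation i′ {j} j∈′)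
    dihedral∩dihedral[n] (j , true)  j∈  j∈′ =
      ⊥-elim (d∤i′-i (∈dihedral⁻ d∣n i (i′ , true)
        (subst (λ k → (k , true) ∈ dihedral d i) (dihedral[n]-reflection i′ {j} j∈′) j∈)))

  module _ {d} (1<d : 1 < d) (d<n : d < n) (d∣n : d ∣ n) where

    rot-d∈dihedral : ∀ i → rot d ∈ dihedral d i
    rot-d∈dihedral i = ∈dihedral⁺ d∣n i (rot d) (mod-pres-∣ d∣n ∣-refl)

    rot-d≢e : rot d ≢ e
    rot-d≢e rot-d≡e = m<n⇒n≢0 1<d (begin
      d               ≡⟨ m<n⇒m%n≡m d<n ⟨
      d % n           ≡⟨ toℕ-mod d ⟨
      toℕ (d mod n)   ≡⟨ cong (toℕ ∘ proj₁) rot-d≡e ⟩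
      0               ∎)
      where open ≡-Reasoning

    center≢rotations : ∀ {C} → (∀ E → IsHyperedge E → E C) → C ≢ rotations
    center≢rotations C∈all C≡A with star-center-meets C∈all (dihedral-vertex 1<d d∣n zero)
    ... | inj₁ C≡D  = reflection∉rotations zero
                        (subst ((zero , true) ∈_) (trans (sym C≡D) C≡A) (reflection∈dihedral d∣n zero))
    ... | inj₂ C∩D  =
      rot-d≢e (C∩D (rot d) (subst (rot d ∈_) (sym C≡A) (rot∈rotations (d mod n))) (rot-d∈dihedral zero))

    center∩rotations≢e : ∀ {C} → (∀ E → IsHyperedge E → E C) → InS C → ¬ TrivInt C rotations
    center∩rotations≢e C∈all (_ , (x@(j , false) , x∈C , x≢e) , _) C∩A = x≢e (C∩A x x∈C (rot∈rotations j))
    center∩rotations≢e C∈all (_ , (x@(j , true)  , x∈C , x≢e) , _) C∩A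
      with star-center-meets C∈all (dihedral-vertex 1<d d∣n j)
    ... | inj₁ C≡D =
      rot-d≢e (C∩A (rot d) (subst (rot d ∈_) (sym C≡D) (rot-d∈dihedral j)) (rot∈rotations (d mod n)))
    ... | inj₂ C∩D = x≢e (C∩D x x∈C (reflection∈dihedral d∣n j))

    composite⇒¬star : ¬ IsStar
    composite⇒¬star (C , (C-inS , _) , C∈all) =
      [ center≢rotations C∈all , center∩rotations≢e C∈all C-inS ]′ (star-center-meets C∈all rotations-vertex)

  star⇒prime : IsStar → Prime n
  star⇒prime star = prime λ (composite {d} d<n d∣n) → composite⇒¬star (nonTrivial⇒n>1 d) d<n d∣n star

  exactlyOneHyperedge⇒star : ExactlyOneHyperedge → IsStar
  exactlyOneHyperedge⇒star (_ , _ , unique) with hyperedge-∋ rotations-vertex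
  ... | E₀ , E₀-edge , rotations∈E₀ = rotations , rotations-vertex , λ E E-edge →
    Equivalence.from (unique E E-edge rotations) (Equivalence.to (unique E₀ E₀-edge rotations) rotations∈E₀)

mainTheorem5 : (n : ℕ) .{{_ : NonZero n}} → 2 ≤ n →
    (Prime n ⇔ Dihedral.ExactlyOneHyperedge n) × (Dihedral.ExactlyOneHyperedge n ⇔ Dihedral.IsStar n)
mainTheorem5 (suc (suc m)) _ =
  mk⇔ prime⇒exactlyOneHyperedge (star⇒prime ∘ exactlyOneHyperedge⇒star) ,
  mk⇔ exactlyOneHyperedge⇒star (prime⇒exactlyOneHyperedge ∘ star⇒prime)
  where open Dihedral≥2 m
mainTheorem5 (suc zero) (s≤s ())
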